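{- Let $f$ be the Fibonacci sequence defined by $f(0) = 1$, $f(1) = 1$, and $f(n) = f(n-1) + f(n-2)$ for $n \geq 2$. Then for every integer $n \geq 2$, $$f(n) = 1 + \sum_{k=0}^{n-2} \sum_{i=0}^{n-k-2} \binom{k}{n-k-i-2}.$$
   Context: Binomial coefficient convention: $\binom{n}{r} = 0$ if $r < 0$ or $r > n$. -}

module Defs where

open import Data.Nat using (ℕ; zero; suc; _+_)

fib : ℕ → ℕ
fib zero = 1
fib (suc zero) = 1
fib (suc (suc n)) = fib (suc n) + fib n

-- Σ[ j = 0 .. m ] g j  (inclusive upper bound m)
sumTo : ℕ → (ℕ → ℕ) → ℕ
sumTo zero g = g 0
sumTo (suc m) g = sumTo m g + g (suc m)

module Submission where

-- Reversing the inner sum, the double sum is Σ_{k+j ≤ n-2} C(k,j); grouping it by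
-- p = k + j gives Σ_{p ≤ n-2} d(p) with d(p) = Σ_k C(k,p-k) the p-th diagonal sum of
-- Pascal's triangle. Pascal's rule shows d(p+2) = d(p+1) + d(p), so d = f, and the
-- classical identity 1 + Σ_{p ≤ m} f(p) = f(m+2) finishes the proof.

open import Defs
open import Data.Nat using (ℕ; zero; suc; _+_; _∸_; _≤_; s≤s)
open import Data.Nat.Properties
  using (+-assoc; +-comm; ∸-+-assoc; +-∸-assoc; n∸n≡0; m≤n⇒m≤1+n; ≤-refl; +-commutativeSemigroup)
open import Data.Nat.Combinatorics using (_C_; nCk+nC[k+1]≡[n+1]C[k+1])
open import Algebra.Properties.CommutativeSemigroup +-commutativeSemigroup using (interchange)
open import Function using (_∘_)
open import Relation.Binary.PropositionalEquality using (_≡_; refl; sym; trans; cong; cong₂)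
open Relation.Binary.PropositionalEquality.≡-Reasoning

m∸n∸o≡m∸o∸n : ∀ m n o → m ∸ n ∸ o ≡ m ∸ o ∸ n
m∸n∸o≡m∸o∸n m n o = begin
  m ∸ n ∸ o    ≡⟨ ∸-+-assoc m n o ⟩
  m ∸ (n + o)  ≡⟨ cong (m ∸_) (+-comm n o) ⟩
  m ∸ (o + n)  ≡⟨ sym (∸-+-assoc m o n) ⟩
  m ∸ o ∸ n    ∎

sumTo-cong : ∀ m {f g : ℕ → ℕ} → (∀ i → i ≤ m → f i ≡ g i) → sumTo m f ≡ sumTo m g
sumTo-cong zero    f≗g = f≗g 0 ≤-refl
sumTo-cong (suc m) f≗g =
  cong₂ _+_ (sumTo-cong m (λ i i≤m → f≗g i (m≤n⇒m≤1+n i≤m))) (f≗g (suc m) ≤-refl)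

sumTo-+ : ∀ m (f g : ℕ → ℕ) → sumTo m (λ i → f i + g i) ≡ sumTo m f + sumTo m g
sumTo-+ zero    f g = refl
sumTo-+ (suc m) f g = trans (cong (_+ (f (suc m) + g (suc m))) (sumTo-+ m f g))
  (interchange (sumTo m f) (sumTo m g) (f (suc m)) (g (suc m)))

sumTo-suc-head : ∀ m (g : ℕ → ℕ) → sumTo (suc m) g ≡ g 0 + sumTo m (g ∘ suc)
sumTo-suc-head zero    g = refl
sumTo-suc-head (suc m) g =
  trans (cong (_+ g (suc (suc m))) (sumTo-suc-head m g)) (+-assoc (g 0) (sumTo m (g ∘ suc)) _)

sumTo-reverse : ∀ m (g : ℕ → ℕ) → sumTo m (λ i → g (m ∸ i)) ≡ sumTo m g
sumTo-reverse zero    g = refl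
sumTo-reverse (suc m) g = begin
  sumTo m (λ i → g (suc m ∸ i)) + g (m ∸ m)  ≡⟨ cong₂ _+_ shifted (cong g (n∸n≡0 m)) ⟩
  sumTo m (g ∘ suc) + g 0                     ≡⟨ +-comm (sumTo m (g ∘ suc)) (g 0) ⟩
  g 0 + sumTo m (g ∘ suc)                     ≡⟨ sym (sumTo-suc-head m g) ⟩
  sumTo (suc m) g                             ∎
  where
  shifted : sumTo m (λ i → g (suc m ∸ i)) ≡ sumTo m (g ∘ suc)
  shifted = trans (sumTo-cong m (λ i i≤m → cong g (+-∸-assoc 1 i≤m))) (sumTo-reverse m (g ∘ suc))

fib-partialSum : ∀ m → 1 + sumTo m fib ≡ fib (suc (suc m))
fib-partialSum zero    = refl
fib-partialSum (suc m) = cong (_+ fib (suc m)) (fib-partialSum m)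

diagonal : ℕ → ℕ
diagonal p = sumTo p (λ k → k C (p ∸ k))

diagonal-suc : ∀ p → diagonal (suc p) ≡ sumTo p (λ k → k C (suc p ∸ k)) + 1
diagonal-suc p = cong (λ j → sumTo p (λ k → k C (suc p ∸ k)) + suc p C j) (n∸n≡0 p)

sumTo-pascal : ∀ p →
  sumTo p (λ k → suc k C (suc p ∸ k)) ≡ diagonal p + sumTo p (λ k → k C (suc p ∸ k))
sumTo-pascal p = trans (sumTo-cong p pascal) (sumTo-+ p (λ k → k C (p ∸ k)) (λ k → k C (suc p ∸ k)))
  where
  pascal : ∀ k → k ≤ p → suc k C (suc p ∸ k) ≡ k C (p ∸ k) + k C (suc p ∸ k)
  pascal k k≤p rewrite +-∸-assoc 1 k≤p = sym (nCk+nC[k+1]≡[n+1]C[k+1] k (p ∸ k))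

-- The k = 0 term of diagonal (p + 2) vanishes since 0 C (p + 2) = 0.
diagonal-rec : ∀ p → diagonal (suc (suc p)) ≡ diagonal (suc p) + diagonal p
diagonal-rec p = begin
  diagonal (suc (suc p))                                     ≡⟨ sumTo-suc-head (suc p) (λ k → k C (suc (suc p) ∸ k)) ⟩
  sumTo p (λ k → suc k C (suc p ∸ k)) + suc (suc p) C (p ∸ p) ≡⟨ cong₂ _+_ (sumTo-pascal p) (cong (suc (suc p) C_) (n∸n≡0 p)) ⟩
  (diagonal p + e) + 1                                       ≡⟨ +-assoc (diagonal p) e 1 ⟩
  diagonal p + (e + 1)                                       ≡⟨ +-comm (diagonal p) (e + 1) ⟩
  (e + 1) + diagonal p                                       ≡⟨ cong (_+ diagonal p) (sym (diagonal-suc p)) ⟩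
  diagonal (suc p) + diagonal p                              ∎
  where
  e = sumTo p (λ k → k C (suc p ∸ k))

fib≡diagonal : ∀ p → fib p ≡ diagonal p
fib≡diagonal zero          = refl
fib≡diagonal (suc zero)    = refl
fib≡diagonal (suc (suc p)) =
  trans (cong₂ _+_ (fib≡diagonal (suc p)) (fib≡diagonal p)) (sym (diagonal-rec p))

triangleSum : ℕ → ℕ
triangleSum m = sumTo m (λ k → sumTo (m ∸ k) (k C_))

triangleSum-suc : ∀ m → triangleSum (suc m) ≡ triangleSum m + diagonal (suc m)
triangleSum-suc m = begin
  sumTo m (λ k → sumTo (suc m ∸ k) (k C_)) + sumTo (m ∸ m) (suc m C_)
    ≡⟨ cong₂ _+_ (trans (sumTo-cong m extendRow) (sumTo-+ m row (λ k → k C (suc m ∸ k))))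
                 (cong (λ j → sumTo j (suc m C_)) (n∸n≡0 m)) ⟩
  (triangleSum m + e) + 1   ≡⟨ +-assoc (triangleSum m) e 1 ⟩
  triangleSum m + (e + 1)   ≡⟨ cong (triangleSum m +_) (sym (diagonal-suc m)) ⟩
  triangleSum m + diagonal (suc m) ∎
  where
  e = sumTo m (λ k → k C (suc m ∸ k))
  row : ℕ → ℕ
  row k = sumTo (m ∸ k) (k C_)
  extendRow : ∀ k → k ≤ m → sumTo (suc m ∸ k) (k C_) ≡ row k + k C (suc m ∸ k)
  extendRow k k≤m rewrite +-∸-assoc 1 k≤m = refl

triangleSum≡sumTo-fib : ∀ m → triangleSum m ≡ sumTo m fib
triangleSum≡sumTo-fib zero    = refl
triangleSum≡sumTo-fib (suc m) =
  trans (triangleSum-suc m) (cong₂ _+_ (triangleSum≡sumTo-fib m) (sym (fib≡diagonal (suc m))))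

doubleSum≡triangleSum : ∀ n →
  sumTo (n ∸ 2) (λ k → sumTo (n ∸ k ∸ 2) (λ i → k C (n ∸ k ∸ i ∸ 2))) ≡ triangleSum (n ∸ 2)
doubleSum≡triangleSum n = sumTo-cong (n ∸ 2) (λ k _ → reversedRow k)
  where
  reversedRow : ∀ k → sumTo (n ∸ k ∸ 2) (λ i → k C (n ∸ k ∸ i ∸ 2)) ≡ sumTo (n ∸ 2 ∸ k) (k C_)
  reversedRow k = begin
    sumTo (n ∸ k ∸ 2) (λ i → k C (n ∸ k ∸ i ∸ 2))
      ≡⟨ sumTo-cong (n ∸ k ∸ 2) (λ i _ → cong (k C_) (m∸n∸o≡m∸o∸n (n ∸ k) i 2)) ⟩
    sumTo (n ∸ k ∸ 2) (λ i → k C (n ∸ k ∸ 2 ∸ i))  ≡⟨ sumTo-reverse (n ∸ k ∸ 2) (k C_) ⟩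
    sumTo (n ∸ k ∸ 2) (k C_)                        ≡⟨ cong (λ j → sumTo j (k C_)) (m∸n∸o≡m∸o∸n n k 2) ⟩
    sumTo (n ∸ 2 ∸ k) (k C_)                        ∎

theorem2p3 : (n : ℕ) → 2 ≤ n →
    fib n ≡ 1 + sumTo (n ∸ 2) (λ k → sumTo (n ∸ k ∸ 2) (λ i → k C (n ∸ k ∸ i ∸ 2)))
theorem2p3 n@(suc (suc m)) _ = begin
  fib n                      ≡⟨ sym (fib-partialSum m) ⟩
  1 + sumTo m fib            ≡⟨ cong (1 +_) (sym (triangleSum≡sumTo-fib m)) ⟩
  1 + triangleSum m          ≡⟨ cong (1 +_) (sym (doubleSum≡triangleSum n)) ⟩
  1 + sumTo (n ∸ 2) (λ k → sumTo (n ∸ k ∸ 2) (λ i → k C (n ∸ k ∸ i ∸ 2))) ∎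
theorem2p3 (suc zero) (s≤s ())
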